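{- Let $v_1,\dots,v_\mu$ be an ordered sequence of vertices with nonnegative distances $d_p(v_i,v_{i+1})$ between consecutive vertices, and time windows $[t(v_i),D(v_i)]$ with $D(v_i)\ge t(v_i)$ for $1\le i\le\mu$. Consider the following algorithm: set $\tau[\mu]=D(v_\mu)$; for $i=\mu-1$ down to $1$: if $\tau[i+1]-d_p(v_i,v_{i+1})<t(v_i)$, return $-\infty$; otherwise set $\tau[i]=\min\{\tau[i+1]-d_p(v_i,v_{i+1}),\,D(v_i)\}$; finally return $\tau[1]$. Then the algorithm returns $-\infty$ if and only if it is impossible to visit the sequence of nodes (in order) within their time windows. Furthermore, if the algorithm returns a finite value, that value is the latest time at which the pursuer can depart node $v_1$ and visit the sequence of nodes (in order) within their time windows.
   Context: A pursuer visits the nodes $v_1,\dots,v_\mu$ in this order within their time windows if there are times $\tau'_1,\dots,\tau'_\mu$ at which it is at the respective nodes, with $\tau'_i\in[t(v_i),D(v_i)]$ for all $i$ and $\tau'_{i+1}\ge \tau'_i+d_p(v_i,v_{i+1})$ for $1\le i\le\mu-1$ (the pursuer may wait at nodes). The time of departing $v_1$ refers to $\tau'_1$.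
   Formalization: The distances $d_p$, the time-window endpoints $t(v_i)$ and $D(v_i)$, and the pursuer's visiting times $\tau'_i$ all take values in the rationals. -}

module Defs where

open import Data.Nat using (ℕ; zero; suc)
open import Data.Fin using (Fin; zero; suc; inject₁)
open import Data.Maybe using (Maybe; just; nothing)
open import Data.Rational using (ℚ; _-_; _+_; _⊓_; _≤_; _<_)
open import Data.Rational.Properties using (_<?_)
open import Relation.Nullary using (yes; no)

-- Times are modelled by ℚ.
-- `nothing` plays the role of the return value −∞.

-- The vertex sequence v₁,…,v_μ is
-- vs : Fin (suc n) → V  (so μ = suc n ≥ 1, vs zero = v₁).
-- Since τ[i] depends only on the suffix v_i,…,v_μ, the loop
-- "for i = μ-1 down to 1" is written as recursion on the suffix.
latestDeparture : {V : Set} (dp : V → V → ℚ) (t D : V → ℚ) →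
                  (n : ℕ) → (Fin (suc n) → V) → Maybe ℚ
latestDeparture dp t D zero vs = just (D (vs zero))
latestDeparture dp t D (suc n) vs with latestDeparture dp t D n (λ i → vs (suc i))
... | nothing = nothing
... | just τ with (τ - dp (vs zero) (vs (suc zero))) <? t (vs zero)
...   | yes _ = nothing
...   | no _  = just ((τ - dp (vs zero) (vs (suc zero))) ⊓ D (vs zero))

-- τs i is the time at which the pursuer is at vs i.
VisitsInOrder : {V : Set} (dp : V → V → ℚ) (t D : V → ℚ) →
                (n : ℕ) → (Fin (suc n) → V) → (Fin (suc n) → ℚ) → Set
VisitsInOrder dp t D n vs τs =
  ((i : Fin (suc n)) → (t (vs i) ≤ τs i) × (τs i ≤ D (vs i))) ×
  ((i : Fin n) → τs (inject₁ i) + dp (vs (inject₁ i)) (vs (suc i)) ≤ τs (suc i))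
  where open import Data.Product using (_×_)

module Submission where

open import Defs
open import Data.Nat using (ℕ; zero; suc)
open import Data.Fin using (Fin; zero; suc; inject₁)
open import Data.Maybe using (Maybe; just; nothing)
open import Data.Rational using (ℚ; 0ℚ; _≤_; _+_; _-_; -_; _⊓_)
open import Data.Rational.Properties
  using (≤-refl; ≤-trans; <-irrefl; <-≤-trans; ≤-<-trans; ≮⇒≥; +-monoˡ-≤; ⊓-glb; p⊓q≤p; p⊓q≤q; _<?_; +-0-group)
open import Algebra.Properties.Group +-0-group using (//-rightDividesˡ; //-rightDividesʳ)
open import Data.Product using (_×_; ∃; _,_; proj₁; proj₂)
open import Relation.Binary.PropositionalEquality using (_≡_; refl; sym; subst)
open import Relation.Nullary using (¬_; yes; no)
open import Data.Empty using (⊥-elim)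
open import Function.Bundles using (_⇔_; mk⇔)

-- Backward induction on the suffix v_i, …, v_μ: the latest feasible time at v_i
-- is the latest time at v_{i+1} minus the travel time, capped by D(v_i); the
-- sequence is infeasible exactly when this falls below t(v_i).

p+r≤q⇒p≤q-r : ∀ {p q} r → p + r ≤ q → p ≤ q - r
p+r≤q⇒p≤q-r {p} {q} r h = subst (_≤ q - r) (//-rightDividesʳ r p) (+-monoˡ-≤ (- r) h)

p≤q-r⇒p+r≤q : ∀ {p q} r → p ≤ q - r → p + r ≤ q
p≤q-r⇒p+r≤q {p} {q} r h = subst (p + r ≤_) (//-rightDividesˡ r q) (+-monoˡ-≤ r h)

module _ {V : Set} (dp : V → V → ℚ) (t D : V → ℚ) where

  Feasible : (n : ℕ) → (Fin (suc n) → V) → Set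
  Feasible n vs = ∃ (VisitsInOrder dp t D n vs)

  IsLatestDeparture : (n : ℕ) → (Fin (suc n) → V) → ℚ → Set
  IsLatestDeparture n vs x =
    ∃ (λ τs → VisitsInOrder dp t D n vs τs × τs zero ≡ x) ×
    ((τs : Fin (suc n) → ℚ) → VisitsInOrder dp t D n vs τs → τs zero ≤ x)

  Correct : (n : ℕ) → (Fin (suc n) → V) → Maybe ℚ → Set
  Correct n vs nothing  = ¬ Feasible n vs
  Correct n vs (just x) = IsLatestDeparture n vs x

  correct-nothing⇔infeasible : ∀ n vs r → Correct n vs r → (r ≡ nothing) ⇔ (¬ Feasible n vs)
  correct-nothing⇔infeasible n vs nothing  infeasible = mk⇔ (λ _ → infeasible) (λ _ → refl)
  correct-nothing⇔infeasible n vs (just x) ((τs , visits , _) , _) =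
    mk⇔ (λ ()) (λ infeasible → ⊥-elim (infeasible (τs , visits)))

  visitsInOrder-tail : ∀ n (vs : Fin (suc (suc n)) → V) τs → VisitsInOrder dp t D (suc n) vs τs →
                       VisitsInOrder dp t D n (λ i → vs (suc i)) (λ i → τs (suc i))
  visitsInOrder-tail n vs τs (windows , travel) = (λ i → windows (suc i)) , (λ i → travel (suc i))

  visitsInOrder-cons : ∀ n (vs : Fin (suc (suc n)) → V) x σs →
                       t (vs zero) ≤ x → x ≤ D (vs zero) →
                       x + dp (vs zero) (vs (suc zero)) ≤ σs zero →
                       VisitsInOrder dp t D n (λ i → vs (suc i)) σs →
                       VisitsInOrder dp t D (suc n) vs λ { zero → x ; (suc i) → σs i }
  visitsInOrder-cons n vs x σs t≤x x≤D first (windows , travel) =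
    (λ { zero → t≤x , x≤D ; (suc i) → windows i }) ,
    (λ { zero → first ; (suc i) → travel i })

  departure≤latest-travel : ∀ n (vs : Fin (suc (suc n)) → V) τ →
    IsLatestDeparture n (λ i → vs (suc i)) τ →
    ∀ τs → VisitsInOrder dp t D (suc n) vs τs → τs zero ≤ τ - dp (vs zero) (vs (suc zero))
  departure≤latest-travel n vs τ (_ , latest) τs visits =
    p+r≤q⇒p≤q-r _ (≤-trans (proj₂ visits zero) (latest _ (visitsInOrder-tail n vs τs visits)))

  latestDeparture-correct : ∀ n (vs : Fin (suc n) → V) →
    ((i : Fin (suc n)) → t (vs i) ≤ D (vs i)) → Correct n vs (latestDeparture dp t D n vs)
  latestDeparture-correct zero vs t≤D =
    ((λ _ → D (vs zero)) , ((λ { zero → t≤D zero , ≤-refl }) , λ ()) , refl) ,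
    λ τs (windows , _) → proj₂ (windows zero)
  latestDeparture-correct (suc n) vs t≤D
    with latestDeparture dp t D n (λ i → vs (suc i))
       | latestDeparture-correct n (λ i → vs (suc i)) (λ i → t≤D (suc i))
  ... | nothing | infeasible = λ (τs , visits) →
    infeasible ((λ i → τs (suc i)) , visitsInOrder-tail n vs τs visits)
  ... | just τ | suffix@((σs , σs-visits , σs₀≡τ) , _)
    with (τ - dp (vs zero) (vs (suc zero))) <? t (vs zero)
  ...   | yes too-late = λ (τs , visits) →
    <-irrefl refl (<-≤-trans (≤-<-trans (departure≤latest-travel n vs τ suffix τs visits) too-late)
                             (proj₁ (proj₁ visits zero)))
  ...   | no in-time =
    (_ , visitsInOrder-cons n vs x σs (⊓-glb (≮⇒≥ in-time) (t≤D zero)) (p⊓q≤q (τ - _) (D (vs zero))) first σs-visits , refl) ,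
    λ τs visits → ⊓-glb (departure≤latest-travel n vs τ suffix τs visits) (proj₂ (proj₁ visits zero))
    where
      x = (τ - dp (vs zero) (vs (suc zero))) ⊓ D (vs zero)
      first : x + dp (vs zero) (vs (suc zero)) ≤ σs zero
      first = subst (x + _ ≤_) (sym σs₀≡τ) (p≤q-r⇒p+r≤q _ (p⊓q≤p (τ - _) (D (vs zero))))

proposition2 : {V : Set} (dp : V → V → ℚ) (t D : V → ℚ) (n : ℕ) (vs : Fin (suc n) → V) →
    ((i : Fin n) → 0ℚ ≤ dp (vs (inject₁ i)) (vs (suc i))) →
    ((i : Fin (suc n)) → t (vs i) ≤ D (vs i)) →
    ((latestDeparture dp t D n vs ≡ nothing) ⇔ (¬ ∃ (λ τs → VisitsInOrder dp t D n vs τs))) ×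
    ((x : ℚ) → latestDeparture dp t D n vs ≡ just x →
      ∃ (λ τs → VisitsInOrder dp t D n vs τs × τs zero ≡ x) ×
      ((τs : Fin (suc n) → ℚ) → VisitsInOrder dp t D n vs τs → τs zero ≤ x))
proposition2 dp t D n vs _ t≤D =
  correct-nothing⇔infeasible dp t D n vs _ correct ,
  λ x eq → subst (Correct dp t D n vs) eq correct
  where
    correct : Correct dp t D n vs (latestDeparture dp t D n vs)
    correct = latestDeparture-correct dp t D n vs t≤D
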